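{- Let $(G_1,e_1),(G_2,e_2)\in\mathcal{G}'$ be such that $H(G_1,e_1)$ and $H(G_2,e_2)$ are connected. If $(G,e)$ is a $2$-sum of $(G_1,e_1)$ and $(G_2,e_2)$, then $H(G,e)$ is (isomorphic to) the product-join of $H(G_1,e_1)$ and $H(G_2,e_2)$ along $X(G_1/e_1)$ and $X(G_2/e_2)$.
   Context: Multigraphs may have loops and parallel edges. A series-parallel graph is a multigraph with no $K_4$ minor. $\mathcal{G}'$ is the set of pairs $(G,e)$ with $G$ a connected series-parallel multigraph and $e\in E(G)$ neither a bridge nor a loop. The $2$-sum of $(G_1,e_1)$ and $(G_2,e_2)$ is obtained from the disjoint union by identifying the edge $e_1$ with $e_2$ (identifying endpoints under some orientation), keeping the merged edge, which is the distinguished edge $e$; thus $E(G)\setminus\{e\} = (E(G_1)\setminus\{e_1\})\sqcup(E(G_2)\setminus\{e_2\})$. For $(G,e)\in\mathcal{G}'$, identify subsets of $E(G)\setminus\{e\}$ with vertices of $Q_{e(G)-1}$; $X(G/e)$ is the set of $S$ with $S\cup\{e\}$ a spanning tree of $G$, $X(G\setminus e)$ the set of $S$ that are spanning trees of $G$, and $H(G,e)$ is the induced subgraph of $Q_{e(G)-1}$ on $X(G/e)\cup X(G\setminus e)$; it is bipartite with parts $X(G/e)$ and $X(G\setminus e)$. Product-join: for connected bipartite $H_1,H_2$ with bipartitions $(A_1,B_1)$, $(A_2,B_2)$, the product-join along $A_1$ and $A_2$ has vertex set $(A_1\times A_2)\sqcup (A_1\times B_2)\sqcup(B_1\times A_2)$,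 where $(a_1,a_2)$ is adjacent to $(a_1,b_2)$ for every $b_2$ adjacent to $a_2$ in $H_2$ and to $(b_1,a_2)$ for every $b_1$ adjacent to $a_1$ in $H_1$, with no other edges. -}

module Defs where

open import Data.Nat using (ℕ)
open import Data.Fin using (Fin)
open import Data.Fin.Subset using (Subset; _∈_; _∉_; _∪_; ⁅_⁆)
open import Data.Vec using (lookup)
open import Data.Product using (Σ; ∃; ∃-syntax; _×_; _,_; proj₁; proj₂; swap)
open import Data.Sum using (_⊎_)
open import Data.Empty using (⊥)
open import Data.Unit using (⊤)
open import Relation.Nullary using (¬_)
open import Relation.Binary.PropositionalEquality using (_≡_; _≢_)
open import Function using (_⇔_)
open import Function.Definitions using (Injective)

-- Vertices are Fin nV, edges are Fin nE, each edge has an (unordered)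
-- pair of endpoints, represented by an ordered pair; all notions below
-- are insensitive to the order.

record MGraph : Set where
  field
    nV    : ℕ
    nE    : ℕ
    ends  : Fin nE → Fin nV × Fin nV

open MGraph public

Vert : MGraph → Set
Vert G = Fin (nV G)

Edge : MGraph → Set
Edge G = Fin (nE G)

Joins : (G : MGraph) → Edge G → Vert G → Vert G → Set
Joins G f x y = (ends G f ≡ (x , y)) ⊎ (ends G f ≡ (y , x))

data Reach (G : MGraph) (P : Edge G → Set) : Vert G → Vert G → Set where
  here : ∀ {x} → Reach G P x x
  step : ∀ {x y z} (f : Edge G) → P f → Joins G f x y → Reach G P y z → Reach G P x z

Connected : MGraph → Set
Connected G = ∀ (x y : Vert G) → Reach G (λ _ → ⊤) x y

IsLoop : (G : MGraph) → Edge G → Set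
IsLoop G f = proj₁ (ends G f) ≡ proj₂ (ends G f)

IsBridge : (G : MGraph) → Edge G → Set
IsBridge G e = ¬ Reach G (λ f → f ≢ e) (proj₁ (ends G e)) (proj₂ (ends G e))

-- K₄ minors, via branch sets (a K₄-model): four nonempty, pairwise
-- disjoint vertex sets, each inducing a connected subgraph, with an edge
-- between every two of them.

InducedEdge : (G : MGraph) → Subset (nV G) → Edge G → Set
InducedEdge G B f = (proj₁ (ends G f) ∈ B) × (proj₂ (ends G f) ∈ B)

HasK4Minor : MGraph → Set
HasK4Minor G =
  Σ (Fin 4 → Subset (nV G)) λ B →
    (∀ i → ∃[ x ] x ∈ B i)
  × (∀ i j → i ≢ j → ∀ x → x ∈ B i → x ∉ B j)
  × (∀ i → ∀ x y → x ∈ B i → y ∈ B i → Reach G (InducedEdge G (B i)) x y)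
  × (∀ i j → i ≢ j → ∃[ f ] ∃[ x ] ∃[ y ] (Joins G f x y × x ∈ B i × y ∈ B j))

SeriesParallel : MGraph → Set
SeriesParallel G = ¬ HasK4Minor G

InG′ : (G : MGraph) → Edge G → Set
InG′ G e = Connected G × SeriesParallel G × ¬ IsBridge G e × ¬ IsLoop G e

-- Spanning trees: connected spanning subgraphs in which every edge is
-- a bridge (i.e. acyclic; loops are excluded since their endpoints are
-- trivially connected).

IsSpanningTree : (G : MGraph) → Subset (nE G) → Set
IsSpanningTree G S =
    (∀ x y → Reach G (λ f → f ∈ S) x y)
  × (∀ f → f ∈ S → ¬ Reach G (λ g → g ∈ S × g ≢ f) (proj₁ (ends G f)) (proj₂ (ends G f)))

record BipGraph : Set₁ where
  field
    Car : Set
    A   : Car → Set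
    B   : Car → Set
    Adj : Car → Car → Set

open BipGraph public

-- H(G,e): subsets of E(G) ∖ {e} (i.e. subsets S of E(G) with e ∉ S),
-- i.e. vertices of the hypercube Q_{e(G)-1}.

XContract : (G : MGraph) → Edge G → Subset (nE G) → Set
XContract G e S = e ∉ S × IsSpanningTree G (S ∪ ⁅ e ⁆)

XDelete : (G : MGraph) → Edge G → Subset (nE G) → Set
XDelete G e S = e ∉ S × IsSpanningTree G S

CubeAdj : ∀ {m} → Subset m → Subset m → Set
CubeAdj {m} S T = ∃[ f ] (lookup S f ≢ lookup T f × (∀ g → g ≢ f → lookup S g ≡ lookup T g))

H : (G : MGraph) → Edge G → BipGraph
H G e = record
  { Car = Subset (nE G)
  ; A   = XContract G e
  ; B   = XDelete G e
  ; Adj = CubeAdj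
  }

VB : (K : BipGraph) → Car K → Set
VB K x = A K x ⊎ B K x

data ConnPath (K : BipGraph) : Car K → Car K → Set where
  here : ∀ {x} → ConnPath K x x
  step : ∀ {x y z} → Adj K x y → VB K y → ConnPath K y z → ConnPath K x z

GraphConnected : BipGraph → Set
GraphConnected K = ∀ x y → VB K x → VB K y → ConnPath K x y

data Tag : Set where
  AA AB BA : Tag

PJCar : BipGraph → BipGraph → Set
PJCar K₁ K₂ = Tag × Car K₁ × Car K₂

PJVert : (K₁ K₂ : BipGraph) → PJCar K₁ K₂ → Set
PJVert K₁ K₂ (AA , x , y) = A K₁ x × A K₂ y
PJVert K₁ K₂ (AB , x , y) = A K₁ x × B K₂ y
PJVert K₁ K₂ (BA , x , y) = B K₁ x × A K₂ y

PJAdj : (K₁ K₂ : BipGraph) → PJCar K₁ K₂ → PJCar K₁ K₂ → Set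
PJAdj K₁ K₂ (AA , x , y) (AB , x′ , y′) = x ≡ x′ × Adj K₂ y y′
PJAdj K₁ K₂ (AB , x , y) (AA , x′ , y′) = x ≡ x′ × Adj K₂ y′ y
PJAdj K₁ K₂ (AA , x , y) (BA , x′ , y′) = y ≡ y′ × Adj K₁ x x′
PJAdj K₁ K₂ (BA , x , y) (AA , x′ , y′) = y ≡ y′ × Adj K₁ x′ x
PJAdj K₁ K₂ _ _ = ⊥

Iso : {C C′ : Set} (V : C → Set) (Adj : C → C → Set)
      (V′ : C′ → Set) (Adj′ : C′ → C′ → Set) → Set
Iso {C} {C′} V Adj V′ Adj′ =
  Σ (C → C′) λ φ → Σ (C′ → C) λ ψ →
      (∀ x → V x → V′ (φ x))
    × (∀ y → V′ y → V (ψ y))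
    × (∀ x → V x → ψ (φ x) ≡ x)
    × (∀ y → V′ y → φ (ψ y) ≡ y)
    × (∀ x x′ → V x → V x′ → (Adj x x′ ⇔ Adj′ (φ x) (φ x′)))

IsoToProductJoin : BipGraph → BipGraph → BipGraph → Set
IsoToProductJoin K K₁ K₂ = Iso (VB K) (Adj K) (PJVert K₁ K₂) (PJAdj K₁ K₂)

-- (G,e) is a 2-sum of (G₁,e₁) and (G₂,e₂) (up to relabelling):
-- G is the disjoint union of G₁ and G₂ with e₁, e₂ merged into e and
-- their endpoints identified (under some orientation).
-- α₁, α₂ embed the vertices, β₁, β₂ embed the edges.

SameEnds : {V : Set} → V × V → V × V → Set
SameEnds p q = (p ≡ q) ⊎ (p ≡ swap q)

mapPair : {V W : Set} → (V → W) → V × V → W × W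
mapPair h (x , y) = h x , h y

IsTwoSum : (G : MGraph) (e : Edge G) (G₁ : MGraph) (e₁ : Edge G₁)
           (G₂ : MGraph) (e₂ : Edge G₂) → Set
IsTwoSum G e G₁ e₁ G₂ e₂ =
  Σ (Vert G₁ → Vert G) λ α₁ → Σ (Vert G₂ → Vert G) λ α₂ →
  Σ (Edge G₁ → Edge G) λ β₁ → Σ (Edge G₂ → Edge G) λ β₂ →
    Injective _≡_ _≡_ α₁
  × Injective _≡_ _≡_ α₂
  × (∀ v → (∃[ x ] α₁ x ≡ v) ⊎ (∃[ y ] α₂ y ≡ v))
  × (∀ x y → α₁ x ≡ α₂ y → (x ≡ proj₁ (ends G₁ e₁)) ⊎ (x ≡ proj₂ (ends G₁ e₁)))
  × Injective _≡_ _≡_ β₁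
  × Injective _≡_ _≡_ β₂
  × β₁ e₁ ≡ e
  × β₂ e₂ ≡ e
  × (∀ f₁ f₂ → β₁ f₁ ≡ β₂ f₂ → f₁ ≡ e₁)
  × (∀ f → (∃[ f₁ ] β₁ f₁ ≡ f) ⊎ (∃[ f₂ ] β₂ f₂ ≡ f))
  -- incidences (the merged edge e gets the identified endpoints)
  × (∀ f₁ → SameEnds (ends G (β₁ f₁)) (mapPair α₁ (ends G₁ f₁)))
  × (∀ f₂ → SameEnds (ends G (β₂ f₂)) (mapPair α₂ (ends G₂ f₂)))

{-# OPTIONS --safe #-}
-- Restricting S ⊆ E(G) ∖ {e} to the two sides, S ↦ (S₁ , S₂), is a bijection onto the pairs
-- avoiding e₁ and e₂; its inverse glues. A walk of G between vertices of G₁ can leave G₁ only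
-- through the ends of e₁, so it corresponds to a walk of G₁ in which every excursion through G₂
-- from one end to the other is replaced by e₁. Hence T is a spanning tree of G iff, for i = 1, 2,
-- the trace of T on Gᵢ (its edges in Gᵢ, plus eᵢ if T joins the ends of eⱼ inside Gⱼ) is a
-- spanning tree of Gᵢ. So S ∪ {e} is a spanning tree iff both Sᵢ ∪ {eᵢ} are, and S is one iff
-- some Sᵢ is and Sⱼ ∪ {eⱼ} is: exactly the three vertex classes of the product join. Adjacency
-- matches because the cube on E(G) ∖ {e} is the Cartesian product of the cubes of the two sides,
-- and on bipartite factors the product join is an induced subgraph of the Cartesian product.
module Submission where

open import Defs
open import Level using (0ℓ)
open import Data.Bool using (Bool; true; false)
open import Data.Empty using (⊥; ⊥-elim)
open import Data.Fin using (Fin; _≟_)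
open import Data.Fin.Subset using (Subset; _∈_; _∉_; _∪_; ⁅_⁆)
open import Data.Fin.Subset.Properties using (_∈?_; x∈p∪q⁺; x∈p∪q⁻; x∈⁅x⁆; x∈⁅y⁆⇒x≡y)
open import Data.List using (List; []; _∷_; allFin)
open import Data.List.Relation.Unary.Any using (here; there)
import Data.List.Membership.Propositional as List
open import Data.List.Membership.Propositional.Properties using (∈-allFin)
open import Data.Nat using (ℕ)
open import Data.Product using (∃; ∃-syntax; ∃₂; _×_; _,_; proj₁; proj₂; uncurry)
import Data.Product as Product
open import Data.Sum using (_⊎_; inj₁; inj₂; [_,_]′)
import Data.Sum as Sum
open import Data.Vec using (lookup; tabulate)
open import Data.Vec.Properties
  using ([]=⇒lookup; lookup⇒[]=; lookup∘tabulate; tabulate∘lookup; tabulate-cong)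
open import Function using (_∘_; _⇔_; mk⇔; Equivalence)
open import Function.Construct.Composition using (_⇔-∘_)
open import Function.Construct.Symmetry using (⇔-sym)
open import Function.Definitions using (Injective)
open import Relation.Binary.PropositionalEquality
open import Relation.Nullary using (¬_; Dec; yes; no)
open import Relation.Nullary.Decidable using (map′; _×-dec_; _⊎-dec_)
open import Relation.Unary using (Pred; _⊆_; _≐_; Decidable)
open import Relation.Unary.Properties using (≐-sym; ≐-trans)

end₁ end₂ : (G : MGraph) → Edge G → Vert G
end₁ G f = proj₁ (ends G f)
end₂ G f = proj₂ (ends G f)

IsEnd : (G : MGraph) → Edge G → Vert G → Set
IsEnd G f x = x ≡ end₁ G f ⊎ x ≡ end₂ G f

_-_ : {A : Set} → Pred A 0ℓ → A → Pred A 0ℓ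
(P - f) g = P g × g ≢ f

Connects : (G : MGraph) → Pred (Edge G) 0ℓ → Edge G → Set
Connects G P f = Reach G P (end₁ G f) (end₂ G f)

Spanning Acyclic Tree : (G : MGraph) → Pred (Edge G) 0ℓ → Set
Spanning G P = ∀ x y → Reach G P x y
Acyclic G P = ∀ f → P f → ¬ Connects G (P - f) f
Tree G P = Spanning G P × Acyclic G P

module _ (G : MGraph) where

  joins-sym : ∀ {f x y} → Joins G f x y → Joins G f y x
  joins-sym (inj₁ eq) = inj₂ eq
  joins-sym (inj₂ eq) = inj₁ eq

  joins-ends : ∀ {f} → Joins G f (end₁ G f) (end₂ G f)
  joins-ends = inj₁ refl

  joins-isEnd : ∀ {f x y} → Joins G f x y → IsEnd G f x
  joins-isEnd (inj₁ refl) = inj₁ refl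
  joins-isEnd (inj₂ refl) = inj₂ refl

  isEnds-joins : ∀ {f x y} → IsEnd G f x → IsEnd G f y → x ≢ y → Joins G f x y
  isEnds-joins (inj₁ refl) (inj₁ refl) x≢y = ⊥-elim (x≢y refl)
  isEnds-joins (inj₁ refl) (inj₂ refl) x≢y = inj₁ refl
  isEnds-joins (inj₂ refl) (inj₁ refl) x≢y = inj₂ refl
  isEnds-joins (inj₂ refl) (inj₂ refl) x≢y = ⊥-elim (x≢y refl)

  joins-unique : ∀ {f a b c d} → Joins G f a b → Joins G f c d →
                 (a ≡ c × b ≡ d) ⊎ (a ≡ d × b ≡ c)
  joins-unique (inj₁ refl) (inj₁ refl) = inj₁ (refl , refl)
  joins-unique (inj₁ refl) (inj₂ refl) = inj₂ (refl , refl)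
  joins-unique (inj₂ refl) (inj₁ refl) = inj₂ (refl , refl)
  joins-unique (inj₂ refl) (inj₂ refl) = inj₁ (refl , refl)

module _ {G : MGraph} where

  reach-trans : ∀ {P x y z} → Reach G P x y → Reach G P y z → Reach G P x z
  reach-trans here w = w
  reach-trans (step f p j v) w = step f p j (reach-trans v w)

  reach-edge : ∀ {P f x y} → P f → Joins G f x y → Reach G P x y
  reach-edge p j = step _ p j here

  reach-sym : ∀ {P x y} → Reach G P x y → Reach G P y x
  reach-sym here = here
  reach-sym (step f p j w) = reach-trans (reach-sym w) (reach-edge p (joins-sym G j))

  reach-mono : ∀ {P Q} → P ⊆ Q → ∀ {x y} → Reach G P x y → Reach G Q x y
  reach-mono P⊆Q here = here
  reach-mono P⊆Q (step f p j w) = step f (P⊆Q p) j (reach-mono P⊆Q w)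

  reach-joins : ∀ {P f a b c d} → Joins G f a b → Joins G f c d → Reach G P a b → Reach G P c d
  reach-joins j j′ w with joins-unique G j j′
  ... | inj₁ (refl , refl) = w
  ... | inj₂ (refl , refl) = reach-sym w

  reach-∪ : ∀ {P Q x y} → Reach G (λ g → P g ⊎ Q g) x y → Reach G P x y ⊎ ∃ Q
  reach-∪ here = inj₁ here
  reach-∪ (step f (inj₂ q) j w) = inj₂ (f , q)
  reach-∪ (step f (inj₁ p) j w) with reach-∪ w
  ... | inj₁ v = inj₁ (step f p j v)
  ... | inj₂ q = inj₂ q

  spanning-mono : ∀ {P Q} → P ⊆ Q → Spanning G P → Spanning G Q
  spanning-mono P⊆Q span x y = reach-mono P⊆Q (span x y)

  acyclic-antitone : ∀ {P Q} → P ⊆ Q → Acyclic G Q → Acyclic G P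
  acyclic-antitone P⊆Q acyc f p w = acyc f (P⊆Q p) (reach-mono (λ (q , ne) → P⊆Q q , ne) w)

  tree-resp : ∀ {P Q} → P ≐ Q → Tree G P → Tree G Q
  tree-resp (P⊆Q , Q⊆P) (span , acyc) = spanning-mono P⊆Q span , acyclic-antitone Q⊆P acyc

  acyclic-minus-not-spanning : ∀ {P f} → Acyclic G P → P f → ¬ Spanning G (P - f)
  acyclic-minus-not-spanning acyc p span = acyc _ p (span _ _)

  Opposite : Pred (Edge G) 0ℓ → Edge G → Vert G → Vert G → Set
  Opposite P f x y = (Reach G P x (end₁ G f) × Reach G P y (end₂ G f))
                   ⊎ (Reach G P x (end₂ G f) × Reach G P y (end₁ G f))

  opposite-mono : ∀ {P Q f x y} → P ⊆ Q → Opposite P f x y → Opposite Q f x y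
  opposite-mono P⊆Q (inj₁ (v , w)) = inj₁ (reach-mono P⊆Q v , reach-mono P⊆Q w)
  opposite-mono P⊆Q (inj₂ (v , w)) = inj₂ (reach-mono P⊆Q v , reach-mono P⊆Q w)

  opposite-cross : ∀ {P f x y} → P f → Opposite P f x y → Reach G P x y
  opposite-cross p (inj₁ (v , w)) = reach-trans v (reach-trans (reach-edge p (inj₁ refl)) (reach-sym w))
  opposite-cross p (inj₂ (v , w)) = reach-trans v (reach-trans (reach-edge p (inj₂ refl)) (reach-sym w))

  opposite-connects : ∀ {P f x y} → Reach G P x y → Opposite P f x y → Connects G P f
  opposite-connects u (inj₁ (v , w)) = reach-trans (reach-sym v) (reach-trans u w)
  opposite-connects u (inj₂ (v , w)) = reach-trans (reach-sym w) (reach-trans (reach-sym u) v)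

  private
    ReachesEnd : Pred (Edge G) 0ℓ → Edge G → Vert G → Set
    ReachesEnd P f y = Reach G P y (end₁ G f) ⊎ Reach G P y (end₂ G f)

    isEnd-reached : ∀ {P f y c} → IsEnd G f c → Reach G P c y → ReachesEnd P f y
    isEnd-reached (inj₁ refl) w = inj₁ (reach-sym w)
    isEnd-reached (inj₂ refl) w = inj₂ (reach-sym w)

    end-meets : ∀ {P f x y} → IsEnd G f x → ReachesEnd P f y → Reach G P x y ⊎ Opposite P f x y
    end-meets (inj₁ refl) (inj₁ w) = inj₁ (reach-sym w)
    end-meets (inj₁ refl) (inj₂ w) = inj₂ (inj₁ (here , w))
    end-meets (inj₂ refl) (inj₁ w) = inj₂ (inj₂ (here , w))
    end-meets (inj₂ refl) (inj₂ w) = inj₁ (reach-sym w)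

    opposite-prepend : ∀ {P f x x′ y} → Reach G P x x′ → Opposite P f x′ y → Opposite P f x y
    opposite-prepend u (inj₁ (v , w)) = inj₁ (reach-trans u v , w)
    opposite-prepend u (inj₂ (v , w)) = inj₂ (reach-trans u v , w)

    far-end-reached : ∀ {P f x y z} → Joins G f x y →
                      Reach G (P - f) y z ⊎ (P f × Opposite (P - f) f y z) → ReachesEnd (P - f) f z
    far-end-reached j (inj₁ w) = isEnd-reached (joins-isEnd G (joins-sym G j)) w
    far-end-reached j (inj₂ (_ , inj₁ (_ , w))) = inj₂ w
    far-end-reached j (inj₂ (_ , inj₂ (_ , w))) = inj₁ w

  cut : ∀ {P} f {x y} → Reach G P x y → Reach G (P - f) x y ⊎ (P f × Opposite (P - f) f x y)
  cut f here = inj₁ here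
  cut f (step g p j w) with g ≟ f | cut f w
  ... | no g≢f | inj₁ v = inj₁ (step g (p , g≢f) j v)
  ... | no g≢f | inj₂ (pf , opp) = inj₂ (pf , opposite-prepend (reach-edge (p , g≢f) j) opp)
  ... | yes refl | rest = Sum.map₂ (p ,_) (end-meets (joins-isEnd G j) (far-end-reached j rest))

  private
    _within_ : Pred (Edge G) 0ℓ → List (Edge G) → Pred (Edge G) 0ℓ
    (P within L) g = P g × g List.∈ L

    module Within (P : Pred (Edge G) 0ℓ) where

      within-[] : ∀ {x y} → Reach G (P within []) x y → x ≡ y
      within-[] here = refl

      within-drop : ∀ {f L} → (P within (f ∷ L)) - f ⊆ P within L
      within-drop ((p , here refl) , f≢f) = ⊥-elim (f≢f refl)
      within-drop ((p , there g∈L) , _) = p , g∈L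

      within-cut : ∀ {f L x y} → Reach G (P within (f ∷ L)) x y →
                   Reach G (P within L) x y ⊎ (P f × Opposite ((P within (f ∷ L)) - f) f x y)
      within-cut {f} w with cut f w
      ... | inj₁ v = inj₁ (reach-mono within-drop v)
      ... | inj₂ ((p , _) , opp) = inj₂ (p , opp)

      within-allFin : P ⊆ P within allFin _
      within-allFin {g} p = p , ∈-allFin g

      module _ (P? : Decidable P) where

        reach-within? : ∀ L x y → Dec (Reach G (P within L) x y)
        reach-within? [] x y = map′ (λ { refl → here }) within-[] (x ≟ y)
        reach-within? (f ∷ L) x y = map′ extend shrink (reach-within? L x y ⊎-dec (P? f ×-dec opposite?))
          where
            opposite? : Dec (Opposite (P within L) f x y)
            opposite? = (reach-within? L x (end₁ G f) ×-dec reach-within? L y (end₂ G f))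
                  ⊎-dec (reach-within? L x (end₂ G f) ×-dec reach-within? L y (end₁ G f))
            widen : P within L ⊆ P within (f ∷ L)
            widen (p , g∈L) = p , there g∈L
            extend : Reach G (P within L) x y ⊎ (P f × Opposite (P within L) f x y) →
                     Reach G (P within (f ∷ L)) x y
            extend (inj₁ w) = reach-mono widen w
            extend (inj₂ (p , opp)) = opposite-cross (p , here refl) (opposite-mono widen opp)
            shrink : Reach G (P within (f ∷ L)) x y →
                     Reach G (P within L) x y ⊎ (P f × Opposite (P within L) f x y)
            shrink w = Sum.map₂ (Product.map₂ (opposite-mono within-drop)) (within-cut w)

  reach? : ∀ {P} → Decidable P → ∀ x y → Dec (Reach G P x y)
  reach? {P} P? x y = map′ (reach-mono proj₁) (reach-mono within-allFin) (reach-within? P? (allFin _) x y)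
    where open Within P

  acyclic-disjoint-walks : ∀ {T P Q x y} → Acyclic G T → P ⊆ T → Q ⊆ T → (∀ {g} → P g → ¬ Q g) →
                           Reach G P x y → Reach G Q x y → x ≡ y
  acyclic-disjoint-walks {T} {P} {Q} {x} {y} acyc P⊆T Q⊆T disjoint u v =
    go (allFin _) (reach-mono within-allFin u)
    where
      open Within P
      -- Induction on a list bounding the edges of the first walk: cutting it at the head f either
      -- drops f from the list or, together with the second walk, closes a cycle through f.
      go : ∀ L → Reach G (P within L) x y → x ≡ y
      go [] w = within-[] w
      go (f ∷ L) w with within-cut w
      ... | inj₁ w′ = go L w′
      ... | inj₂ (p , opp) = ⊥-elim (acyc f (P⊆T p) (opposite-connects v′ (opposite-mono avoid opp)))
        where
          v′ : Reach G (T - f) x y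
          v′ = reach-mono (λ q → Q⊆T q , λ { refl → ⊥-elim (disjoint p q) }) v
          avoid : (P within (f ∷ L)) - f ⊆ T - f
          avoid ((q , _) , g≢f) = P⊆T q , g≢f

module _ {n : ℕ} where

  lookup-transfer : ∀ {S S′ : Subset n} {g} → lookup S g ≡ lookup S′ g → g ∈ S′ → g ∈ S
  lookup-transfer {S} eq g∈S′ = lookup⇒[]= _ S (trans eq ([]=⇒lookup g∈S′))

  ∉⇒lookup : ∀ {S : Subset n} {g} → g ∉ S → lookup S g ≡ false
  ∉⇒lookup {S} {g} g∉S with lookup S g in eq
  ... | true = ⊥-elim (g∉S (lookup⇒[]= g S eq))
  ... | false = refl

  cube-sym : ∀ {S S′ : Subset n} → CubeAdj S S′ → CubeAdj S′ S
  cube-sym (f , differ , agree) = f , differ ∘ sym , λ g g≢f → sym (agree g g≢f)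

  private
    drop-one : ∀ {f} {S S′ : Subset n} → lookup S f ≡ true → lookup S′ f ≡ false →
               (∀ g → g ≢ f → lookup S g ≡ lookup S′ g) → f ∈ S × (_∈ S′) ⊆ ((_∈ S) - f)
    drop-one {f} {S} {S′} f∈S f∉S′ agree =
      lookup⇒[]= f S f∈S , λ g∈S′ → lookup-transfer (agree _ (g≢f g∈S′)) g∈S′ , g≢f g∈S′
      where
        g≢f : ∀ {g} → g ∈ S′ → g ≢ f
        g≢f g∈S′ refl with () ← trans (sym ([]=⇒lookup g∈S′)) f∉S′

  cube-step : ∀ {S S′ : Subset n} → CubeAdj S S′ →
              ∃[ f ] ((f ∈ S × (_∈ S′) ⊆ ((_∈ S) - f)) ⊎ (f ∈ S′ × (_∈ S) ⊆ ((_∈ S′) - f)))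
  cube-step {S} {S′} (f , differ , agree) with lookup S f in eq | lookup S′ f in eq′
  ... | true  | false = f , inj₁ (drop-one eq eq′ agree)
  ... | false | true  = f , inj₂ (drop-one eq′ eq (λ g g≢f → sym (agree g g≢f)))
  ... | true  | true  = ⊥-elim (differ refl)
  ... | false | false = ⊥-elim (differ refl)

_∪｛_｝ : ∀ {n} → Subset n → Fin n → Pred (Fin n) 0ℓ
(S ∪｛ ε ｝) g = g ∈ S ⊎ g ≡ ε

module _ (Γ : MGraph) (ε : Edge Γ) where

  ∪⁅⁆≐ : ∀ {S : Subset (nE Γ)} → (_∈ S ∪ ⁅ ε ⁆) ≐ (S ∪｛ ε ｝)
  ∪⁅⁆≐ {S} = to , from
    where
      to : (_∈ S ∪ ⁅ ε ⁆) ⊆ (S ∪｛ ε ｝)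
      to g∈ with x∈p∪q⁻ S ⁅ ε ⁆ g∈
      ... | inj₁ g∈S = inj₁ g∈S
      ... | inj₂ g∈ε = inj₂ (x∈⁅y⁆⇒x≡y ε g∈ε)
      from : (S ∪｛ ε ｝) ⊆ (_∈ S ∪ ⁅ ε ⁆)
      from (inj₁ g∈S) = x∈p∪q⁺ (inj₁ g∈S)
      from (inj₂ refl) = x∈p∪q⁺ (inj₂ (x∈⁅x⁆ ε))

  contract⇒tree : ∀ {S} → XContract Γ ε S → Tree Γ (S ∪｛ ε ｝)
  contract⇒tree (_ , tree) = tree-resp ∪⁅⁆≐ tree

  tree⇒contract : ∀ {S} → ε ∉ S → Tree Γ (S ∪｛ ε ｝) → XContract Γ ε S
  tree⇒contract ε∉S tree = ε∉S , tree-resp (proj₂ ∪⁅⁆≐ , proj₁ ∪⁅⁆≐) tree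

  contract-disconnected : ∀ {S} → XContract Γ ε S → ¬ Connects Γ (_∈ S) ε
  contract-disconnected c@(ε∉S , _) w =
    proj₂ (contract⇒tree c) ε (inj₂ refl)
      (reach-mono (λ g∈S → inj₁ g∈S , λ { refl → ε∉S g∈S }) w)

  delete-connected : ∀ {S} → XDelete Γ ε S → Connects Γ (_∈ S) ε
  delete-connected (_ , span , _) = span _ _

record Bipartite (K : BipGraph) : Set where
  field
    adj-sym       : ∀ {x y} → Adj K x y → Adj K y x
    A-independent : ∀ {x y} → A K x → A K y → ¬ Adj K x y
    B-independent : ∀ {x y} → B K x → B K y → ¬ Adj K x y
    A-B-disjoint  : ∀ {x} → A K x → ¬ B K x

H-bipartite : (Γ : MGraph) (ε : Edge Γ) → Bipartite (H Γ ε)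
H-bipartite Γ ε = record
  { adj-sym       = λ {S S′} → cube-sym {S = S} {S′ = S′}
  ; A-independent = contract-independent
  ; B-independent = delete-independent
  ; A-B-disjoint  = λ c d → contract-disconnected Γ ε c (delete-connected Γ ε d)
  }
  where
    cannot-drop : ∀ {P P′ f} → Tree Γ P → Spanning Γ P′ → P f → P′ ⊆ P - f → ⊥
    cannot-drop (_ , acyc) span′ pf P′⊆P-f =
      acyclic-minus-not-spanning acyc pf (spanning-mono P′⊆P-f span′)

    delete-independent : ∀ {S S′} → XDelete Γ ε S → XDelete Γ ε S′ → ¬ CubeAdj S S′
    delete-independent (_ , tree) (_ , tree′) adj with cube-step adj
    ... | _ , inj₁ (f∈S , S′⊆S-f) = cannot-drop tree (proj₁ tree′) f∈S S′⊆S-f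
    ... | _ , inj₂ (f∈S′ , S⊆S′-f) = cannot-drop tree′ (proj₁ tree) f∈S′ S⊆S′-f

    add-ε : ∀ {S S′ f} → ε ∉ S → f ∈ S → (_∈ S′) ⊆ ((_∈ S) - f) →
            (S′ ∪｛ ε ｝) ⊆ ((S ∪｛ ε ｝) - f)
    add-ε _   _   S′⊆S-f (inj₁ g∈S′) = inj₁ (proj₁ (S′⊆S-f g∈S′)) , proj₂ (S′⊆S-f g∈S′)
    add-ε ε∉S f∈S _      (inj₂ refl) = inj₂ refl , λ { refl → ε∉S f∈S }

    contract-independent : ∀ {S S′} → XContract Γ ε S → XContract Γ ε S′ → ¬ CubeAdj S S′
    contract-independent c c′ adj with cube-step adj
    ... | _ , inj₁ (f∈S , S′⊆S-f) =
      cannot-drop (contract⇒tree Γ ε c) (proj₁ (contract⇒tree Γ ε c′)) (inj₁ f∈S)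
                  (add-ε (proj₁ c) f∈S S′⊆S-f)
    ... | _ , inj₂ (f∈S′ , S⊆S′-f) =
      cannot-drop (contract⇒tree Γ ε c′) (proj₁ (contract⇒tree Γ ε c)) (inj₁ f∈S′)
                  (add-ε (proj₁ c′) f∈S′ S⊆S′-f)

CartesianAdj : {C₁ C₂ : Set} → (C₁ → C₁ → Set) → (C₂ → C₂ → Set) → C₁ × C₂ → C₁ × C₂ → Set
CartesianAdj R₁ R₂ (x , y) (x′ , y′) = (x ≡ x′ × R₂ y y′) ⊎ (R₁ x x′ × y ≡ y′)

module _ {K₁ K₂ : BipGraph} (bip₁ : Bipartite K₁) (bip₂ : Bipartite K₂) where
  open Bipartite bip₁ renaming (adj-sym to sym₁; A-independent to A-indep₁; B-independent to B-indep₁;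
                                A-B-disjoint to disj₁)
  open Bipartite bip₂ renaming (adj-sym to sym₂; A-independent to A-indep₂; B-independent to B-indep₂;
                                A-B-disjoint to disj₂)

  productJoin-cartesian : ∀ {t t′ x x′ y y′} →
    PJVert K₁ K₂ (t , x , y) → PJVert K₁ K₂ (t′ , x′ , y′) →
    PJAdj K₁ K₂ (t , x , y) (t′ , x′ , y′) ⇔ CartesianAdj (Adj K₁) (Adj K₂) (x , y) (x′ , y′)
  productJoin-cartesian {t} {t′} v v′ = mk⇔ (to t t′) (from t t′ v v′)
    where
      to : ∀ t t′ {x x′ y y′} → PJAdj K₁ K₂ (t , x , y) (t′ , x′ , y′) →
           CartesianAdj (Adj K₁) (Adj K₂) (x , y) (x′ , y′)
      to AA AB (x≡ , adj) = inj₁ (x≡ , adj)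
      to AB AA (x≡ , adj) = inj₁ (x≡ , sym₂ adj)
      to AA BA (y≡ , adj) = inj₂ (adj , y≡)
      to BA AA (y≡ , adj) = inj₂ (sym₁ adj , y≡)
      to AA AA ()
      to AB AB ()
      to AB BA ()
      to BA AB ()
      to BA BA ()
      from : ∀ t t′ {x x′ y y′} → PJVert K₁ K₂ (t , x , y) → PJVert K₁ K₂ (t′ , x′ , y′) →
             CartesianAdj (Adj K₁) (Adj K₂) (x , y) (x′ , y′) →
             PJAdj K₁ K₂ (t , x , y) (t′ , x′ , y′)
      from AA AB _ _ (inj₁ (x≡ , adj)) = x≡ , adj
      from AB AA _ _ (inj₁ (x≡ , adj)) = x≡ , sym₂ adj
      from AA BA _ _ (inj₂ (adj , y≡)) = y≡ , adj
      from BA AA _ _ (inj₂ (adj , y≡)) = y≡ , sym₁ adj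
      from AA AA (_ , a) (_ , a′) (inj₁ (_ , adj)) = ⊥-elim (A-indep₂ a a′ adj)
      from AA AA (a , _) (a′ , _) (inj₂ (adj , _)) = ⊥-elim (A-indep₁ a a′ adj)
      from AA AB (a , _) (a′ , _) (inj₂ (adj , _)) = ⊥-elim (A-indep₁ a a′ adj)
      from AA BA (a , _) (b , _) (inj₁ (refl , _)) = ⊥-elim (disj₁ a b)
      from AB AA (a , _) (a′ , _) (inj₂ (adj , _)) = ⊥-elim (A-indep₁ a a′ adj)
      from AB AB (_ , b) (_ , b′) (inj₁ (_ , adj)) = ⊥-elim (B-indep₂ b b′ adj)
      from AB AB (a , _) (a′ , _) (inj₂ (adj , _)) = ⊥-elim (A-indep₁ a a′ adj)
      from AB BA (a , _) (b , _) (inj₁ (refl , _)) = ⊥-elim (disj₁ a b)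
      from AB BA (_ , b) (_ , a) (inj₂ (_ , refl)) = ⊥-elim (disj₂ a b)
      from BA AA (b , _) (a , _) (inj₁ (refl , _)) = ⊥-elim (disj₁ a b)
      from BA AB (b , _) (a , _) (inj₁ (refl , _)) = ⊥-elim (disj₁ a b)
      from BA AB (_ , a) (_ , b) (inj₂ (_ , refl)) = ⊥-elim (disj₂ a b)
      from BA BA (_ , a) (_ , a′) (inj₁ (_ , adj)) = ⊥-elim (A-indep₂ a a′ adj)
      from BA BA (b , _) (b′ , _) (inj₂ (adj , _)) = ⊥-elim (B-indep₁ b b′ adj)

connects? : (Γ : MGraph) (ε : Edge Γ) (S : Subset (nE Γ)) → Dec (Connects Γ (_∈ S) ε)
connects? Γ ε S = reach? (_∈? S) _ _

module _ (G₁ : MGraph) (e₁ : Edge G₁) (G₂ : MGraph) (e₂ : Edge G₂) where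

  -- The isomorphism must be defined on every subset, so the tag is computed by deciding reachability.
  tag : Subset (nE G₁) → Subset (nE G₂) → Tag
  tag T₁ T₂ with connects? G₁ e₁ T₁ | connects? G₂ e₂ T₂
  ... | yes _ | _     = BA
  ... | no _  | yes _ = AB
  ... | no _  | no _  = AA

  tag-correct : ∀ {t T₁ T₂} → PJVert (H G₁ e₁) (H G₂ e₂) (t , T₁ , T₂) → tag T₁ T₂ ≡ t
  tag-correct {AA} {T₁} {T₂} (c₁ , c₂) with connects? G₁ e₁ T₁ | connects? G₂ e₂ T₂
  ... | yes d | _     = ⊥-elim (contract-disconnected G₁ e₁ c₁ d)
  ... | no _  | yes d = ⊥-elim (contract-disconnected G₂ e₂ c₂ d)
  ... | no _  | no _  = refl
  tag-correct {AB} {T₁} {T₂} (c₁ , d₂) with connects? G₁ e₁ T₁ | connects? G₂ e₂ T₂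
  ... | yes d | _     = ⊥-elim (contract-disconnected G₁ e₁ c₁ d)
  ... | no _  | yes _ = refl
  ... | no _  | no ¬d = ⊥-elim (¬d (delete-connected G₂ e₂ d₂))
  tag-correct {BA} {T₁} (d₁ , _) with connects? G₁ e₁ T₁
  ... | yes _ = refl
  ... | no ¬d = ⊥-elim (¬d (delete-connected G₁ e₁ d₁))

module Morphism (Γ G : MGraph) (α : Vert Γ → Vert G) (β : Edge Γ → Edge G)
                (incident : ∀ f → Joins G (β f) (α (end₁ Γ f)) (α (end₂ Γ f))) where

  map-joins : ∀ {f s t} → Joins Γ f s t → Joins G (β f) (α s) (α t)
  map-joins (inj₁ refl) = incident _
  map-joins (inj₂ refl) = joins-sym G (incident _)

  pull-joins : ∀ {f v w} → Joins G (β f) v w → ∃₂ λ s t → v ≡ α s × w ≡ α t × Joins Γ f s t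
  pull-joins j with joins-unique G (incident _) j
  ... | inj₁ (refl , refl) = _ , _ , refl , refl , inj₁ refl
  ... | inj₂ (refl , refl) = _ , _ , refl , refl , inj₂ refl

  map-reach : ∀ {P x y} → Reach Γ (P ∘ β) x y → Reach G P (α x) (α y)
  map-reach here = here
  map-reach (step f p j w) = step (β f) p (map-joins j) (map-reach w)

preimage : ∀ {m n} → (Fin m → Fin n) → Subset n → Subset m
preimage β S = tabulate (lookup S ∘ β)

lookup-preimage : ∀ {m n} (β : Fin m → Fin n) (S : Subset n) g → lookup (preimage β S) g ≡ lookup S (β g)
lookup-preimage β S = lookup∘tabulate (lookup S ∘ β)

module _ {m n} {β : Fin m → Fin n} {S : Subset n} where

  ∈-preimage : (_∈ preimage β S) ≐ (_∈ S) ∘ β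
  ∈-preimage = (λ {g} g∈ → lookup⇒[]= (β g) S (trans (sym (lookup-preimage β S g)) ([]=⇒lookup g∈)))
             , (λ {g} βg∈ → lookup⇒[]= g _ (trans (lookup-preimage β S g) ([]=⇒lookup βg∈)))

-- IsTwoSum with named fields, completed by shared₂ and β-overlap₂, the mirror images of its
-- conditions, so that the two summands can be exchanged.
record TwoSum (G : MGraph) (e : Edge G) (G₁ : MGraph) (e₁ : Edge G₁) (G₂ : MGraph) (e₂ : Edge G₂)
  : Set where
  field
    α₁ : Vert G₁ → Vert G
    α₂ : Vert G₂ → Vert G
    β₁ : Edge G₁ → Edge G
    β₂ : Edge G₂ → Edge G
    α₁-injective : Injective _≡_ _≡_ α₁
    α₂-injective : Injective _≡_ _≡_ α₂
    α-cover : ∀ v → (∃[ x ] α₁ x ≡ v) ⊎ (∃[ y ] α₂ y ≡ v)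
    shared₁ : ∀ {x y} → α₁ x ≡ α₂ y → IsEnd G₁ e₁ x
    shared₂ : ∀ {x y} → α₁ x ≡ α₂ y → IsEnd G₂ e₂ y
    β₁-injective : Injective _≡_ _≡_ β₁
    β₂-injective : Injective _≡_ _≡_ β₂
    β₁-e : β₁ e₁ ≡ e
    β₂-e : β₂ e₂ ≡ e
    β-overlap₁ : ∀ {f₁ f₂} → β₁ f₁ ≡ β₂ f₂ → f₁ ≡ e₁
    β-overlap₂ : ∀ {f₁ f₂} → β₁ f₁ ≡ β₂ f₂ → f₂ ≡ e₂
    β-cover : ∀ f → (∃[ f₁ ] β₁ f₁ ≡ f) ⊎ (∃[ f₂ ] β₂ f₂ ≡ f)
    incident₁ : ∀ f → Joins G (β₁ f) (α₁ (end₁ G₁ f)) (α₁ (end₂ G₁ f))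
    incident₂ : ∀ f → Joins G (β₂ f) (α₂ (end₁ G₂ f)) (α₂ (end₂ G₂ f))

module _ {G : MGraph} {e : Edge G} {G₁ : MGraph} {e₁ : Edge G₁} {G₂ : MGraph} {e₂ : Edge G₂} where

  swap : TwoSum G e G₁ e₁ G₂ e₂ → TwoSum G e G₂ e₂ G₁ e₁
  swap σ = record
    { α₁ = α₂ ; α₂ = α₁ ; β₁ = β₂ ; β₂ = β₁
    ; α₁-injective = α₂-injective ; α₂-injective = α₁-injective
    ; α-cover = Sum.swap ∘ α-cover
    ; shared₁ = shared₂ ∘ sym ; shared₂ = shared₁ ∘ sym
    ; β₁-injective = β₂-injective ; β₂-injective = β₁-injective
    ; β₁-e = β₂-e ; β₂-e = β₁-e
    ; β-overlap₁ = β-overlap₂ ∘ sym ; β-overlap₂ = β-overlap₁ ∘ sym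
    ; β-cover = Sum.swap ∘ β-cover
    ; incident₁ = incident₂ ; incident₂ = incident₁
    }
    where open TwoSum σ

  fromIsTwoSum : IsTwoSum G e G₁ e₁ G₂ e₂ → TwoSum G e G₁ e₁ G₂ e₂
  fromIsTwoSum (α₁ , α₂ , β₁ , β₂ , α₁-inj , α₂-inj , α-cover , shared₁ ,
                β₁-inj , β₂-inj , β₁-e , β₂-e , β-overlap₁ , β-cover , incident₁ , incident₂) = record
    { α₁ = α₁ ; α₂ = α₂ ; β₁ = β₁ ; β₂ = β₂
    ; α₁-injective = α₁-inj ; α₂-injective = α₂-inj
    ; α-cover = α-cover
    ; shared₁ = shared₁ _ _ ; shared₂ = shared₂
    ; β₁-injective = β₁-inj ; β₂-injective = β₂-inj
    ; β₁-e = β₁-e ; β₂-e = β₂-e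
    ; β-overlap₁ = β-overlap₁ _ _ ; β-overlap₂ = β-overlap₂
    ; β-cover = β-cover
    ; incident₁ = incident₁ ; incident₂ = incident₂
    }
    where
      β-overlap₂ : ∀ {f₁ f₂} → β₁ f₁ ≡ β₂ f₂ → f₂ ≡ e₂
      β-overlap₂ eq with refl ← β-overlap₁ _ _ eq = β₂-inj (trans (sym eq) (trans β₁-e (sym β₂-e)))

      shared₂ : ∀ {x y} → α₁ x ≡ α₂ y → IsEnd G₂ e₂ y
      shared₂ {x} eq with joins-unique G (subst (λ f → Joins G f _ _) β₁-e (incident₁ e₁))
                                       (subst (λ f → Joins G f _ _) β₂-e (incident₂ e₂))
                        | shared₁ x _ eq
      ... | inj₁ (same , _)    | inj₁ refl = inj₁ (α₂-inj (trans (sym eq) same))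
      ... | inj₁ (_ , same)    | inj₂ refl = inj₂ (α₂-inj (trans (sym eq) same))
      ... | inj₂ (crossed , _) | inj₁ refl = inj₂ (α₂-inj (trans (sym eq) crossed))
      ... | inj₂ (_ , crossed) | inj₂ refl = inj₁ (α₂-inj (trans (sym eq) crossed))

module Side {G : MGraph} {e : Edge G} {G₁ : MGraph} {e₁ : Edge G₁} {G₂ : MGraph} {e₂ : Edge G₂}
            (σ : TwoSum G e G₁ e₁ G₂ e₂) where

  open TwoSum σ
  module M₁ = Morphism G₁ G α₁ β₁ incident₁
  module M₂ = Morphism G₂ G α₂ β₂ incident₂

  joins-e₁ : Joins G e (α₁ (end₁ G₁ e₁)) (α₁ (end₂ G₁ e₁))
  joins-e₁ = subst (λ f → Joins G f _ _) β₁-e (incident₁ e₁)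

  joins-e₂ : Joins G e (α₂ (end₁ G₂ e₂)) (α₂ (end₂ G₂ e₂))
  joins-e₂ = subst (λ f → Joins G f _ _) β₂-e (incident₂ e₂)

  -- The trace of P on G₁: e₁ stands for a P-path through G₂ between the ends of e₂.
  _⁺ : Pred (Edge G) 0ℓ → Pred (Edge G₁) 0ℓ
  (P ⁺) g = P (β₁ g) ⊎ (g ≡ e₁ × Connects G₂ (P ∘ β₂) e₂)

  module _ (P : Pred (Edge G) 0ℓ) where

    lift : ∀ {x y} → Reach G₁ (P ⁺) x y → Reach G P (α₁ x) (α₁ y)
    lift here = here
    lift (step g (inj₁ p) j w) = step (β₁ g) p (M₁.map-joins j) (lift w)
    lift (step g (inj₂ (refl , c)) j w) =
      reach-trans (reach-joins joins-e₂ (subst (λ f → Joins G f _ _) β₁-e (M₁.map-joins j))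
                                        (M₂.map-reach c))
                  (lift w)

    detour : ∀ {c z y t} → α₁ c ≡ α₂ z → α₁ y ≡ α₂ t →
             Reach G₂ (P ∘ β₂) z t → Reach G₁ (P ⁺) c y
    detour {c} {z} {y} {t} c~z y~t w with c ≟ y
    ... | yes refl = here
    ... | no c≢y = reach-edge (inj₂ (refl , connects)) (isEnds-joins G₁ (shared₁ c~z) (shared₁ y~t) c≢y)
      where
        z≢t : z ≢ t
        z≢t refl = c≢y (α₁-injective (trans c~z (sym y~t)))
        connects : Connects G₂ (P ∘ β₂) e₂
        connects = reach-joins (isEnds-joins G₂ (shared₂ c~z) (shared₂ y~t) z≢t) (joins-ends G₂) w

    -- A P-walk from α₁ x enters and leaves G₂ only through shared vertices, which are ends of e₁;
    -- detour turns each excursion into e₁ or into nothing.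
    module _ (x : Vert G₁) where

      Reached : Vert G → Set
      Reached v = (∀ {y} → α₁ y ≡ v → Reach G₁ (P ⁺) x y)
                × (∀ {z} → α₂ z ≡ v → ∃₂ λ c z′ → α₁ c ≡ α₂ z′
                                               × Reach G₁ (P ⁺) x c × Reach G₂ (P ∘ β₂) z′ z)

      reached-start : Reached (α₁ x)
      reached-start = (λ eq → subst (Reach G₁ (P ⁺) x) (α₁-injective (sym eq)) here)
                    , λ eq → x , _ , sym eq , here , here

      reached-step : ∀ {g v w} → P g → Joins G g v w → Reached v → Reached w
      reached-step {g} p j (at₁ , at₂) with β-cover g
      ... | inj₁ (g₁ , refl) with M₁.pull-joins j
      ... | s , t , refl , refl , j₁ = to₁ , to₂
        where
          x~t : Reach G₁ (P ⁺) x t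
          x~t = reach-trans (at₁ refl) (reach-edge (inj₁ p) j₁)
          to₁ : ∀ {y} → α₁ y ≡ α₁ t → Reach G₁ (P ⁺) x y
          to₁ eq with refl ← α₁-injective eq = x~t
          to₂ : ∀ {z} → α₂ z ≡ α₁ t → _
          to₂ eq = t , _ , sym eq , x~t , here
      reached-step {g} p j (at₁ , at₂) | inj₂ (g₂ , refl) with M₂.pull-joins j
      ... | s , t , refl , refl , j₂ with at₂ refl
      ... | c , z′ , c~z′ , x~c , z′~s = to₁ , to₂
        where
          z′~t : Reach G₂ (P ∘ β₂) z′ t
          z′~t = reach-trans z′~s (reach-edge p j₂)
          to₁ : ∀ {y} → α₁ y ≡ α₂ t → Reach G₁ (P ⁺) x y
          to₁ eq = reach-trans x~c (detour c~z′ eq z′~t)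
          to₂ : ∀ {z} → α₂ z ≡ α₂ t → _
          to₂ eq with refl ← α₂-injective eq = c , z′ , c~z′ , x~c , z′~t

      reached-walk : ∀ {v w} → Reach G P v w → Reached v → Reached w
      reached-walk here r = r
      reached-walk (step g p j w) r = reached-walk w (reached-step p j r)

    project : ∀ {x y} → Reach G P (α₁ x) (α₁ y) → Reach G₁ (P ⁺) x y
    project {x} w = proj₁ (reached-walk x w (reached-start x)) refl

  shared-vertex : ∃₂ λ c z → α₁ c ≡ α₂ z
  shared-vertex with joins-unique G joins-e₁ joins-e₂
  ... | inj₁ (same , _) = _ , _ , same
  ... | inj₂ (crossed , _) = _ , _ , crossed

  module _ {P : Pred (Edge G) 0ℓ} (span₁ : ∀ x y → Reach G P (α₁ x) (α₁ y))
                                 (span₂ : ∀ x y → Reach G P (α₂ x) (α₂ y)) where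

    private
      across : ∀ x y → Reach G P (α₁ x) (α₂ y)
      across x y with c , z , c~z ← shared-vertex =
        reach-trans (span₁ x c) (subst (λ u → Reach G P u (α₂ y)) (sym c~z) (span₂ z y))

    spanning-cover : Spanning G P
    spanning-cover v w with α-cover v | α-cover w
    ... | inj₁ (x , refl) | inj₁ (y , refl) = span₁ x y
    ... | inj₂ (x , refl) | inj₂ (y , refl) = span₂ x y
    ... | inj₁ (x , refl) | inj₂ (y , refl) = across x y
    ... | inj₂ (x , refl) | inj₁ (y , refl) = reach-sym (across y x)

  ⁺-spanning : ∀ {P} → Spanning G P → Spanning G₁ (P ⁺)
  ⁺-spanning {P} span x y = project P (span _ _)

  ⁺-acyclic : ∀ {P} → ¬ IsLoop G₁ e₁ → Acyclic G P → Acyclic G₁ (P ⁺)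
  ⁺-acyclic {P} _ acyc f (inj₁ p) w =
    acyc (β₁ f) p (reach-joins (incident₁ f) (joins-ends G) (lift (P - β₁ f) (reach-mono shift w)))
    where
      shift : (P ⁺) - f ⊆ (P - β₁ f) ⁺
      shift (inj₁ p′ , g≢f) = inj₁ (p′ , g≢f ∘ β₁-injective)
      shift (inj₂ (refl , c) , e₁≢f) =
        inj₂ (refl , reach-mono (λ p′ → p′ , λ eq → e₁≢f (sym (β-overlap₁ (sym eq)))) c)
  -- Here P joins the ends of e both through G₁ - e₁ and through G₂: a cycle unless e₁ is a loop.
  ⁺-acyclic {P} e₁-nonloop acyc .e₁ (inj₂ (refl , c)) w =
    e₁-nonloop (α₁-injective (acyclic-disjoint-walks acyc proj₁ proj₁ disjoint walk₁ walk₂))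
    where
      Via₁ Via₂ : Pred (Edge G) 0ℓ
      Via₁ g = P g × ∃[ g₁ ] (β₁ g₁ ≡ g × g₁ ≢ e₁)
      Via₂ g = P g × ∃[ g₂ ] β₂ g₂ ≡ g
      disjoint : ∀ {g} → Via₁ g → ¬ Via₂ g
      disjoint (_ , _ , refl , g₁≢e₁) (_ , _ , eq) = g₁≢e₁ (β-overlap₁ (sym eq))
      via₁ : (P ⁺) - e₁ ⊆ Via₁ ∘ β₁
      via₁ (inj₁ p , g≢e₁) = p , _ , refl , g≢e₁
      via₁ (inj₂ (refl , _) , e₁≢e₁) = ⊥-elim (e₁≢e₁ refl)
      walk₁ : Reach G Via₁ (α₁ (end₁ G₁ e₁)) (α₁ (end₂ G₁ e₁))
      walk₁ = M₁.map-reach {P = Via₁} (reach-mono via₁ w)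
      walk₂ : Reach G Via₂ (α₁ (end₁ G₁ e₁)) (α₁ (end₂ G₁ e₁))
      walk₂ = reach-joins joins-e₂ joins-e₁ (M₂.map-reach {P = Via₂} (reach-mono (λ p → p , _ , refl) c))

  no-cycle-through-β₁ : ∀ {P} → Acyclic G₁ (P ⁺) → Acyclic G₂ (P ∘ β₂) →
                        ∀ f → P (β₁ f) → ¬ Connects G (P - β₁ f) (β₁ f)
  no-cycle-through-β₁ {P} acyc₁ acyc₂ f p w
    with project (P - β₁ f) (reach-joins (joins-ends G) (incident₁ f) w) | f ≟ e₁
  ... | w₁ | no f≢e₁ = acyc₁ f (inj₁ p) (reach-mono shift w₁)
    where
      shift : (P - β₁ f) ⁺ ⊆ (P ⁺) - f
      shift (inj₁ (p′ , ne)) = inj₁ p′ , ne ∘ cong β₁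
      shift (inj₂ (refl , c)) = inj₂ (refl , reach-mono proj₁ c) , f≢e₁ ∘ sym
  ... | w₁ | yes refl with reach-∪ w₁
  ... | inj₁ w₁′ = acyc₁ e₁ (inj₁ p) (reach-mono (λ (p′ , ne) → inj₁ p′ , ne ∘ cong β₁) w₁′)
  ... | inj₂ (_ , _ , c) =
    acyc₂ e₂ (subst P (trans β₁-e (sym β₂-e)) p)
             (reach-mono (λ (p′ , ne) → p′ , λ { refl → ne (trans β₂-e (sym β₁-e)) }) c)

  ⁺-of-e : ∀ {P} → P e → P ⁺ ≐ P ∘ β₁
  ⁺-of-e {P} pe = (λ { (inj₁ p) → p ; (inj₂ (refl , _)) → subst P (sym β₁-e) pe }) , inj₁

  ⁺-connected : ∀ {P} → Connects G₂ (P ∘ β₂) e₂ → P ⁺ ≐ (λ g → P (β₁ g) ⊎ g ≡ e₁)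
  ⁺-connected c = (λ { (inj₁ p) → inj₁ p ; (inj₂ (refl , _)) → inj₂ refl })
                , (λ { (inj₁ p) → inj₁ p ; (inj₂ refl) → inj₂ (refl , c) })

  ⁺-disconnected : ∀ {P} → ¬ Connects G₂ (P ∘ β₂) e₂ → P ⁺ ≐ P ∘ β₁
  ⁺-disconnected ¬c = (λ { (inj₁ p) → p ; (inj₂ (_ , c)) → ⊥-elim (¬c c) }) , inj₁

  restrict : Subset (nE G) → Subset (nE G₁)
  restrict = preimage β₁

  module _ {S : Subset (nE G)} where

    restrict-avoids : e ∉ S → e₁ ∉ restrict S
    restrict-avoids e∉S e₁∈ = e∉S (subst (_∈ S) β₁-e (proj₁ ∈-preimage e₁∈))

    restrict-avoids⁻ : e₁ ∉ restrict S → e ∉ S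
    restrict-avoids⁻ e₁∉ e∈S = e₁∉ (proj₂ ∈-preimage (subst (_∈ S) (sym β₁-e) e∈S))

    restrict-connects : Connects G₁ (_∈ restrict S) e₁ ⇔ Connects G₁ ((_∈ S) ∘ β₁) e₁
    restrict-connects = mk⇔ (reach-mono (proj₁ ∈-preimage)) (reach-mono (proj₂ ∈-preimage))

    ⁺-contract : (S ∪｛ e ｝) ⁺ ≐ (restrict S ∪｛ e₁ ｝)
    ⁺-contract = ≐-trans (⁺-of-e {S ∪｛ e ｝} (inj₂ refl)) (shrink , extend)
      where
        shrink : (S ∪｛ e ｝) ∘ β₁ ⊆ (restrict S ∪｛ e₁ ｝)
        shrink (inj₁ βg∈S) = inj₁ (proj₂ ∈-preimage βg∈S)
        shrink (inj₂ βg≡e) = inj₂ (β₁-injective (trans βg≡e (sym β₁-e)))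
        extend : (restrict S ∪｛ e₁ ｝) ⊆ (S ∪｛ e ｝) ∘ β₁
        extend (inj₁ g∈) = inj₁ (proj₁ ∈-preimage g∈)
        extend (inj₂ refl) = inj₂ β₁-e

    ⁺-delete-connected : Connects G₂ ((_∈ S) ∘ β₂) e₂ → (_∈ S) ⁺ ≐ (restrict S ∪｛ e₁ ｝)
    ⁺-delete-connected c =
      ≐-trans (⁺-connected {_∈ S} c) (Sum.map₁ (proj₂ ∈-preimage) , Sum.map₁ (proj₁ ∈-preimage))

    ⁺-delete-disconnected : ¬ Connects G₂ ((_∈ S) ∘ β₂) e₂ → (_∈ S) ⁺ ≐ (_∈ restrict S)
    ⁺-delete-disconnected ¬c = ≐-trans (⁺-disconnected {_∈ S} ¬c) (≐-sym ∈-preimage)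

    cube-restrict : ∀ {S′ f} → e ∉ S → e ∉ S′ → lookup S (β₁ f) ≢ lookup S′ (β₁ f) →
                 (∀ g → g ≢ β₁ f → lookup S g ≡ lookup S′ g) →
                 CubeAdj (restrict S) (restrict S′) × preimage β₂ S ≡ preimage β₂ S′
    cube-restrict {S′} {f} e∉S e∉S′ differ agree = (f , differ₁ , agree₁) , tabulate-cong agree₂
      where
        differ₁ : lookup (restrict S) f ≢ lookup (restrict S′) f
        differ₁ eq = differ (trans (sym (lookup-preimage β₁ S f)) (trans eq (lookup-preimage β₁ S′ f)))
        agree₁ : ∀ g → g ≢ f → lookup (restrict S) g ≡ lookup (restrict S′) g
        agree₁ g g≢f = trans (lookup-preimage β₁ S g)
                             (trans (agree (β₁ g) (g≢f ∘ β₁-injective)) (sym (lookup-preimage β₁ S′ g)))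
        f≢e₁ : f ≢ e₁
        f≢e₁ refl = differ (subst (λ f → lookup S f ≡ lookup S′ f) (sym β₁-e)
                                  (trans (∉⇒lookup e∉S) (sym (∉⇒lookup e∉S′))))
        agree₂ : ∀ h → lookup S (β₂ h) ≡ lookup S′ (β₂ h)
        agree₂ h = agree (β₂ h) (λ eq → f≢e₁ (β-overlap₁ (sym eq)))

    cube-extend : ∀ {S′} → CubeAdj (restrict S) (restrict S′) → preimage β₂ S ≡ preimage β₂ S′ →
                  CubeAdj S S′
    cube-extend {S′} (f , differ , agree) same₂ = β₁ f , differ′ , agree′
      where
        differ′ : lookup S (β₁ f) ≢ lookup S′ (β₁ f)
        differ′ eq = differ (trans (lookup-preimage β₁ S f) (trans eq (sym (lookup-preimage β₁ S′ f))))
        agree′ : ∀ g → g ≢ β₁ f → lookup S g ≡ lookup S′ g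
        agree′ g g≢βf with β-cover g
        ... | inj₁ (g₁ , refl) =
          trans (sym (lookup-preimage β₁ S g₁))
                (trans (agree g₁ (g≢βf ∘ cong β₁)) (lookup-preimage β₁ S′ g₁))
        ... | inj₂ (g₂ , refl) =
          trans (sym (lookup-preimage β₂ S g₂))
                (trans (cong (λ T → lookup T g₂) same₂) (lookup-preimage β₂ S′ g₂))

  Origin : Edge G → Set
  Origin f = (∃[ f₁ ] β₁ f₁ ≡ f) ⊎ (∃[ f₂ ] β₂ f₂ ≡ f)

  pick : Subset (nE G₁) → Subset (nE G₂) → ∀ {f} → Origin f → Bool
  pick T₁ T₂ = [ lookup T₁ ∘ proj₁ , lookup T₂ ∘ proj₁ ]′

  glue : Subset (nE G₁) → Subset (nE G₂) → Subset (nE G)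
  glue T₁ T₂ = tabulate (λ f → pick T₁ T₂ (β-cover f))

  glue-restrict : ∀ S → glue (restrict S) (preimage β₂ S) ≡ S
  glue-restrict S = trans (tabulate-cong (λ f → pick-restrict (β-cover f))) (tabulate∘lookup S)
    where
      pick-restrict : ∀ {f} (o : Origin f) → pick (restrict S) (preimage β₂ S) o ≡ lookup S f
      pick-restrict (inj₁ (f₁ , refl)) = lookup-preimage β₁ S f₁
      pick-restrict (inj₂ (f₂ , refl)) = lookup-preimage β₂ S f₂

  restrict-glue : ∀ {T₁ T₂} → e₁ ∉ T₁ → e₂ ∉ T₂ → restrict (glue T₁ T₂) ≡ T₁
  restrict-glue {T₁} {T₂} e₁∉T₁ e₂∉T₂ =
    trans (tabulate-cong (λ g → trans (lookup∘tabulate _ (β₁ g)) (pick-β₁ (β-cover (β₁ g)))))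
          (tabulate∘lookup T₁)
    where
      pick-β₁ : ∀ {g} (o : Origin (β₁ g)) → pick T₁ T₂ o ≡ lookup T₁ g
      pick-β₁ (inj₁ (_ , eq)) = cong (lookup T₁) (β₁-injective eq)
      pick-β₁ (inj₂ (_ , eq)) with refl ← β-overlap₁ (sym eq) | refl ← β-overlap₂ (sym eq) =
        trans (∉⇒lookup e₂∉T₂) (sym (∉⇒lookup e₁∉T₁))

module SpanningTrees {G : MGraph} {e : Edge G} {G₁ : MGraph} {e₁ : Edge G₁} {G₂ : MGraph} {e₂ : Edge G₂}
                     (σ : TwoSum G e G₁ e₁ G₂ e₂)
                     (e₁-nonloop : ¬ IsLoop G₁ e₁) (e₂-nonloop : ¬ IsLoop G₂ e₂) where

  open TwoSum σ
  module S₁ = Side σ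
  module S₂ = Side (swap σ)
  open S₁ using () renaming (_⁺ to _⁺₁)
  open S₂ using () renaming (_⁺ to _⁺₂)

  tree-decomposition : ∀ {P} → Tree G P ⇔ (Tree G₁ (P ⁺₁) × Tree G₂ (P ⁺₂))
  tree-decomposition {P} = mk⇔ split join
    where
      split : Tree G P → Tree G₁ (P ⁺₁) × Tree G₂ (P ⁺₂)
      split (span , acyc) = (S₁.⁺-spanning span , S₁.⁺-acyclic e₁-nonloop acyc)
                          , (S₂.⁺-spanning span , S₂.⁺-acyclic e₂-nonloop acyc)
      join : Tree G₁ (P ⁺₁) × Tree G₂ (P ⁺₂) → Tree G P
      join ((span₁ , acyc₁) , (span₂ , acyc₂)) = S₁.spanning-cover (λ x y → S₁.lift P (span₁ x y))
                                                                   (λ x y → S₂.lift P (span₂ x y))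
                                                , acyclic
        where
          acyclic : Acyclic G P
          acyclic f p with β-cover f
          ... | inj₁ (f₁ , refl) = S₁.no-cycle-through-β₁ acyc₁ (acyclic-antitone inj₁ acyc₂) f₁ p
          ... | inj₂ (f₂ , refl) = S₂.no-cycle-through-β₁ acyc₂ (acyclic-antitone inj₁ acyc₁) f₂ p

  module _ {S : Subset (nE G)} where

    contract⇔ : XContract G e S ⇔ (XContract G₁ e₁ (S₁.restrict S) × XContract G₂ e₂ (S₂.restrict S))
    contract⇔ = mk⇔ split join
      where
        split : XContract G e S → XContract G₁ e₁ (S₁.restrict S) × XContract G₂ e₂ (S₂.restrict S)
        split c@(e∉S , _) with tree₁ , tree₂ ← Equivalence.to tree-decomposition (contract⇒tree G e c) =
            tree⇒contract G₁ e₁ (S₁.restrict-avoids e∉S) (tree-resp S₁.⁺-contract tree₁)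
          , tree⇒contract G₂ e₂ (S₂.restrict-avoids e∉S) (tree-resp S₂.⁺-contract tree₂)
        join : XContract G₁ e₁ (S₁.restrict S) × XContract G₂ e₂ (S₂.restrict S) → XContract G e S
        join (c₁ , c₂) = tree⇒contract G e (S₁.restrict-avoids⁻ (proj₁ c₁))
          (Equivalence.from tree-decomposition
            ( tree-resp (≐-sym S₁.⁺-contract) (contract⇒tree G₁ e₁ c₁)
            , tree-resp (≐-sym S₂.⁺-contract) (contract⇒tree G₂ e₂ c₂)))

    delete-connects : XDelete G e S →
                      Connects G₁ (_∈ S₁.restrict S) e₁ ⊎ Connects G₂ (_∈ S₂.restrict S) e₂
    delete-connects (_ , tree) with reach-∪ (proj₁ (proj₁ (Equivalence.to tree-decomposition tree)) _ _)
    ... | inj₁ w = inj₁ (Equivalence.from S₁.restrict-connects w)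
    ... | inj₂ (_ , _ , c) = inj₂ (Equivalence.from S₂.restrict-connects c)

    delete-split : XDelete G e S → Connects G₁ (_∈ S₁.restrict S) e₁ →
                   XDelete G₁ e₁ (S₁.restrict S) × XContract G₂ e₂ (S₂.restrict S)
    delete-split (e∉S , tree) c₁ with tree₁ , tree₂ ← Equivalence.to tree-decomposition tree =
      (S₁.restrict-avoids e∉S , tree-resp (S₁.⁺-delete-disconnected ¬c₂) tree₁) , contract₂
      where
        contract₂ : XContract G₂ e₂ (S₂.restrict S)
        contract₂ = tree⇒contract G₂ e₂ (S₂.restrict-avoids e∉S)
                      (tree-resp (S₂.⁺-delete-connected (Equivalence.to S₁.restrict-connects c₁)) tree₂)
        ¬c₂ : ¬ Connects G₂ ((_∈ S) ∘ β₂) e₂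
        ¬c₂ = contract-disconnected G₂ e₂ contract₂ ∘ Equivalence.from S₂.restrict-connects

    delete-join : e ∉ S → XDelete G₁ e₁ (S₁.restrict S) → XContract G₂ e₂ (S₂.restrict S) →
                  XDelete G e S
    delete-join e∉S d₁@(_ , tree₁) c₂ = e∉S , Equivalence.from tree-decomposition
      ( tree-resp (≐-sym (S₁.⁺-delete-disconnected ¬c₂)) tree₁
      , tree-resp (≐-sym (S₂.⁺-delete-connected c₁)) (contract⇒tree G₂ e₂ c₂))
      where
        c₁ : Connects G₁ ((_∈ S) ∘ β₁) e₁
        c₁ = Equivalence.to S₁.restrict-connects (delete-connected G₁ e₁ d₁)
        ¬c₂ : ¬ Connects G₂ ((_∈ S) ∘ β₂) e₂
        ¬c₂ = contract-disconnected G₂ e₂ c₂ ∘ Equivalence.from S₂.restrict-connects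

module Isomorphism {G : MGraph} {e : Edge G} {G₁ : MGraph} {e₁ : Edge G₁} {G₂ : MGraph} {e₂ : Edge G₂}
                   (σ : TwoSum G e G₁ e₁ G₂ e₂)
                   (e₁-nonloop : ¬ IsLoop G₁ e₁) (e₂-nonloop : ¬ IsLoop G₂ e₂) where

  open TwoSum σ
  module T₁ = SpanningTrees σ e₁-nonloop e₂-nonloop
  module T₂ = SpanningTrees (swap σ) e₂-nonloop e₁-nonloop
  module S₁ = Side σ
  module S₂ = Side (swap σ)
  open S₁ using () renaming (restrict to restrict₁)
  open S₂ using () renaming (restrict to restrict₂)

  H₁ H₂ : BipGraph
  H₁ = H G₁ e₁
  H₂ = H G₂ e₂

  ρ : Subset (nE G) → Subset (nE G₁) × Subset (nE G₂)
  ρ S = restrict₁ S , restrict₂ S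

  φ : Subset (nE G) → PJCar H₁ H₂
  φ S = tag G₁ e₁ G₂ e₂ (restrict₁ S) (restrict₂ S) , ρ S

  ψ : PJCar H₁ H₂ → Subset (nE G)
  ψ (_ , T₁ , T₂) = S₁.glue T₁ T₂

  classify : ∀ {S} → VB (H G e) S → ∃[ t ] PJVert H₁ H₂ (t , ρ S)
  classify (inj₁ c) = AA , Equivalence.to T₁.contract⇔ c
  classify (inj₂ d) with T₁.delete-connects d
  ... | inj₁ c₁ = BA , T₁.delete-split d c₁
  ... | inj₂ c₂ = AB , Product.swap (T₂.delete-split d c₂)

  declassify : ∀ {t S} → PJVert H₁ H₂ (t , ρ S) → VB (H G e) S
  declassify {AA} v = inj₁ (Equivalence.from T₁.contract⇔ v)
  declassify {BA} (d₁ , c₂) = inj₂ (T₁.delete-join (S₁.restrict-avoids⁻ (proj₁ d₁)) d₁ c₂)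
  declassify {AB} (c₁ , d₂) = inj₂ (T₂.delete-join (S₂.restrict-avoids⁻ (proj₁ d₂)) d₂ c₁)

  vertex-avoids : ∀ {S} → VB (H G e) S → e ∉ S
  vertex-avoids (inj₁ (e∉S , _)) = e∉S
  vertex-avoids (inj₂ (e∉S , _)) = e∉S

  pj-avoids : ∀ {t T₁ T₂} → PJVert H₁ H₂ (t , T₁ , T₂) → e₁ ∉ T₁ × e₂ ∉ T₂
  pj-avoids {AA} ((e₁∉ , _) , (e₂∉ , _)) = e₁∉ , e₂∉
  pj-avoids {AB} ((e₁∉ , _) , (e₂∉ , _)) = e₁∉ , e₂∉
  pj-avoids {BA} ((e₁∉ , _) , (e₂∉ , _)) = e₁∉ , e₂∉

  glue-swap : ∀ T₁ T₂ → S₂.glue T₂ T₁ ≡ S₁.glue T₁ T₂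
  glue-swap T₁ T₂ = tabulate-cong (λ f → pick-swap (β-cover f))
    where
      pick-swap : ∀ {f} (o : S₁.Origin f) → S₂.pick T₂ T₁ (Sum.swap o) ≡ S₁.pick T₁ T₂ o
      pick-swap (inj₁ _) = refl
      pick-swap (inj₂ _) = refl

  ρ-ψ : ∀ {t T₁ T₂} → PJVert H₁ H₂ (t , T₁ , T₂) → ρ (ψ (t , T₁ , T₂)) ≡ (T₁ , T₂)
  ρ-ψ {T₁ = T₁} {T₂} v with e₁∉ , e₂∉ ← pj-avoids v =
    cong₂ _,_ (S₁.restrict-glue e₁∉ e₂∉)
              (trans (cong restrict₂ (sym (glue-swap T₁ T₂))) (S₂.restrict-glue e₂∉ e₁∉))

  φ-vertex : ∀ S → VB (H G e) S → PJVert H₁ H₂ (φ S)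
  φ-vertex S v with t , w ← classify v =
    subst (λ t → PJVert H₁ H₂ (t , ρ S)) (sym (tag-correct G₁ e₁ G₂ e₂ w)) w

  ψ-vertex : ∀ y → PJVert H₁ H₂ y → VB (H G e) (ψ y)
  ψ-vertex y@(t , _) v = declassify (subst (λ ρS → PJVert H₁ H₂ (t , ρS)) (sym (ρ-ψ v)) v)

  φψ : ∀ y → PJVert H₁ H₂ y → φ (ψ y) ≡ y
  φψ (t , _) v =
    cong₂ _,_ (trans (cong (uncurry (tag G₁ e₁ G₂ e₂)) (ρ-ψ v)) (tag-correct G₁ e₁ G₂ e₂ v)) (ρ-ψ v)

  cube⇔ : ∀ {S S′} → e ∉ S → e ∉ S′ → CubeAdj S S′ ⇔ CartesianAdj CubeAdj CubeAdj (ρ S) (ρ S′)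
  cube⇔ {S} {S′} e∉S e∉S′ = mk⇔ to from
    where
      to : CubeAdj S S′ → CartesianAdj CubeAdj CubeAdj (ρ S) (ρ S′)
      to (f , differ , agree) with β-cover f
      ... | inj₁ (_ , refl) with adj , same ← S₁.cube-restrict e∉S e∉S′ differ agree = inj₂ (adj , same)
      ... | inj₂ (_ , refl) with adj , same ← S₂.cube-restrict e∉S e∉S′ differ agree = inj₁ (same , adj)
      from : CartesianAdj CubeAdj CubeAdj (ρ S) (ρ S′) → CubeAdj S S′
      from (inj₁ (same , adj)) = S₂.cube-extend {S} {S′} adj same
      from (inj₂ (adj , same)) = S₁.cube-extend {S} {S′} adj same

  adjacency : ∀ S S′ → VB (H G e) S → VB (H G e) S′ → CubeAdj S S′ ⇔ PJAdj H₁ H₂ (φ S) (φ S′)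
  adjacency S S′ v v′ =
    ⇔-sym (productJoin-cartesian (H-bipartite G₁ e₁) (H-bipartite G₂ e₂) (φ-vertex S v) (φ-vertex S′ v′))
    ⇔-∘ cube⇔ (vertex-avoids v) (vertex-avoids v′)

  iso : IsoToProductJoin (H G e) H₁ H₂
  iso = φ , ψ , φ-vertex , ψ-vertex , (λ S _ → S₁.glue-restrict S) , φψ , adjacency

proposition4p6 : (G₁ : MGraph) (e₁ : Edge G₁) (G₂ : MGraph) (e₂ : Edge G₂)
                 (G : MGraph) (e : Edge G)
               → InG′ G₁ e₁ → InG′ G₂ e₂
               → GraphConnected (H G₁ e₁) → GraphConnected (H G₂ e₂)
               → IsTwoSum G e G₁ e₁ G₂ e₂
               → IsoToProductJoin (H G e) (H G₁ e₁) (H G₂ e₂)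
proposition4p6 G₁ e₁ G₂ e₂ G e (_ , _ , _ , e₁-nonloop) (_ , _ , _ , e₂-nonloop) _ _ twoSum =
  Isomorphism.iso (fromIsTwoSum twoSum) e₁-nonloop e₂-nonloop
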